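{- Let $A$ be a Petri net, let $\mathbf{C}$ be an SCCC of $A$, and let $I\subseteq\{1,\ldots,d\}$ be such that $\mathbf{C}|_I$ is finite. Then the graph $G_{\mathbf{C},I}=(Q,A,T)$ with $Q=\mathbf{C}|_I$ and $T=\{(\mathbf{x}|_I,a,\mathbf{y}|_I)\mid (\mathbf{x},a,\mathbf{y})\in\mathbf{C}\times A\times\mathbf{C},\ \mathbf{x}\xrightarrow{a}\mathbf{y}\}$ is a structurally-reversible $I$-unfolding of $A$.
   Context: Fix $d\ge1$. A configuration is a vector of $\mathbb{N}^d$. A Petri net action is a pair $a=(\mathbf{a}_-,\mathbf{a}_+)$ of configurations with displacement $\Delta(a)=\mathbf{a}_+-\mathbf{a}_-$; $\mathbf{x}\xrightarrow{a}\mathbf{y}$ iff there is a configuration $\mathbf{c}$ with $\mathbf{x}=\mathbf{a}_-+\mathbf{c}$, $\mathbf{y}=\mathbf{a}_++\mathbf{c}$. For a word $\sigma=a_1\cdots a_k$, $\Delta(\sigma)=\sum_j\Delta(a_j)$ and $\mathbf{x}\xrightarrow{\sigma}\mathbf{y}$ iff there are configurations $\mathbf{c}_0=\mathbf{x},\ldots,\mathbf{c}_k=\mathbf{y}$ with $\mathbf{c}_{j-1}\xrightarrow{a_j}\mathbf{c}_j$. A Petri net is a finite set $A$ of actions; $\mathbf{x}$ and $\mathbf{y}$ are mutually reachable if $\mathbf{x}\xrightarrow{\sigma}\mathbf{y}$ and $\mathbf{y}\xrightarrow{\tau}\mathbf{x}$ for some $\sigma,\tau\in A^*$; the equivalence classes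 of this relation are the SCCCs. For $I\subseteq\{1,\ldots,d\}$, $\mathbf{c}|_I\in\mathbb{N}^I$ is the restriction of $\mathbf{c}$ and $\mathbf{C}|_I=\{\mathbf{c}|_I:\mathbf{c}\in\mathbf{C}\}$; elements of $\mathbb{N}^I$ are $I$-configurations; for $I$-configurations $p,q$, $p\xrightarrow{a}q$ iff $p=\mathbf{a}_-|_I+\mathbf{c}$, $q=\mathbf{a}_+|_I+\mathbf{c}$ for some $\mathbf{c}\in\mathbb{N}^I$. A graph $(Q,A,T)$ has nonempty finite state set $Q$ and transitions $T\subseteq Q\times A\times Q$; paths, their labels and strong connectivity are as usual, and the displacement of a path is that of its label. An $I$-unfolding of $A$ is a strongly-connected graph $G=(Q,A,T)$ with $Q$ a finite set of $I$-configurations and $p\xrightarrow{a}q$ for all $(p,a,q)\in T$; it is structurally-reversible if for every transition $(p,a,q)\in T$ there is a path $\pi$ from $q$ to $p$ with $\Delta(a)+\Delta(\pi)=\mathbf{0}$. -}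

module Defs where

open import Data.Nat using (ℕ; zero; suc; _+_)
open import Data.Integer using (ℤ; _⊖_) renaming (_+_ to _+ℤ_; 0ℤ to 0ℤ)
open import Data.Fin using (Fin)
open import Data.Fin.Subset using (Subset; Side; inside; outside)
open import Data.Vec using (Vec; zipWith; replicate; lookup)
open import Data.List using (List; []; _∷_; foldr)
open import Data.List.Membership.Propositional using (_∈_)
open import Data.Product using (Σ; ∃; ∃-syntax; _×_; _,_)
open import Relation.Binary.PropositionalEquality using (_≡_)

Config : ℕ → Set
Config d = Vec ℕ d

infixl 6 _⊕_
_⊕_ : ∀ {d} → Config d → Config d → Config d
_⊕_ = zipWith _+_

record Action (d : ℕ) : Set where
  constructor ⟨_,_⟩
  field
    pre  : Config d
    post : Config d
open Action public

PetriNet : ℕ → Set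
PetriNet d = List (Action d)

Δ : ∀ {d} → Action d → Vec ℤ d
Δ a = zipWith _⊖_ (post a) (pre a)

zeroVec : ∀ {d} → Vec ℤ d
zeroVec = replicate _ 0ℤ

ΔW : ∀ {d} → List (Action d) → Vec ℤ d
ΔW = foldr (λ a v → zipWith _+ℤ_ (Δ a) v) zeroVec

Step : ∀ {d} → Action d → Config d → Config d → Set
Step a x y = ∃[ c ] (x ≡ pre a ⊕ c × y ≡ post a ⊕ c)

data Run {d} (A : PetriNet d) : Config d → Config d → Set where
  done : ∀ {x} → Run A x x
  step : ∀ {x y z} (a : Action d) → a ∈ A → Step a x y → Run A y z → Run A x z

MutReach : ∀ {d} → PetriNet d → Config d → Config d → Set
MutReach A x y = Run A x y × Run A y x

CSet : ℕ → Set₁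
CSet d = Config d → Set

IsSCCC : ∀ {d} → PetriNet d → CSet d → Set
IsSCCC A C = ∃[ x ] (∀ y → (C y → MutReach A x y) × (MutReach A x y → C y))

Finite : ∀ {d} → CSet d → Set
Finite Q = ∃[ l ] (∀ q → (Q q → q ∈ l) × (q ∈ l → Q q))

-- Restriction to I ⊆ {1..d}.
-- Encoding: an I-configuration (element of ℕ^I) is represented by a vector
-- of ℕ^d whose coordinates outside I are 0; c|_I zeroes coordinates outside I.

keep : Side → ℕ → ℕ
keep inside  n = n
keep outside n = 0

restrict : ∀ {d} → Subset d → Config d → Config d
restrict I x = zipWith keep I x

IConfig : ∀ {d} → Subset d → Config d → Set
IConfig {d} I q = ∀ (i : Fin d) → lookup I i ≡ outside → lookup q i ≡ 0

RestrictSet : ∀ {d} → Subset d → CSet d → CSet d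
RestrictSet I C q = ∃[ x ] (C x × restrict I x ≡ q)

IStep : ∀ {d} → Subset d → Action d → Config d → Config d → Set
IStep I a p q = ∃[ c ] (IConfig I c × p ≡ restrict I (pre a) ⊕ c × q ≡ restrict I (post a) ⊕ c)

TSet : ℕ → Set₁
TSet d = Config d → Action d → Config d → Set

data Path {d} (T : TSet d) : Config d → Config d → List (Action d) → Set where
  nil  : ∀ {p} → Path T p p []
  cons : ∀ {p q r w} (a : Action d) → T p a q → Path T q r w → Path T p r (a ∷ w)

IsGraph : ∀ {d} → PetriNet d → CSet d → TSet d → Set
IsGraph A Q T =
  (∃[ q ] Q q) × Finite Q ×
  (∀ p a q → T p a q → Q p × a ∈ A × Q q)

StronglyConnected : ∀ {d} → CSet d → TSet d → Set
StronglyConnected Q T = ∀ p q → Q p → Q q → ∃[ w ] Path T p q w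

IsIUnfolding : ∀ {d} → PetriNet d → Subset d → CSet d → TSet d → Set
IsIUnfolding A I Q T =
  IsGraph A Q T × StronglyConnected Q T ×
  (∀ q → Q q → IConfig I q) ×
  (∀ p a q → T p a q → IStep I a p q)

StructurallyReversible : ∀ {d} → TSet d → Set
StructurallyReversible T =
  ∀ p a q → T p a q → ∃[ w ] (Path T q p w × zipWith _+ℤ_ (Δ a) (ΔW w) ≡ zeroVec)

GQ : ∀ {d} → CSet d → Subset d → CSet d
GQ C I = RestrictSet I C

GT : ∀ {d} → PetriNet d → CSet d → Subset d → TSet d
GT A C I p a q = ∃[ x ] ∃[ y ] (C x × C y × a ∈ A × Step a x y × restrict I x ≡ p × restrict I y ≡ q)

-- Every configuration visited by a run between two members of an SCCC C is again
-- in C, so restricting the run to I yields a path of G_{C,I} with the same label;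
-- its displacement is the run's, i.e. the difference of its endpoints. Strong
-- connectivity follows from mutual reachability inside C, and for a transition
-- x —a→ y of C the run back from y to x gives a return path whose displacement
-- cancels Δ(a).
module Submission where

open import Defs
open import Data.Nat using (ℕ; _≤_)
open import Data.Fin.Subset using (Subset)
open import Data.Product using (_×_)

open import Data.Nat as ℕ using ()
open import Data.Integer using (ℤ; +_; -_; _⊖_) renaming (_+_ to _+ℤ_)
import Data.Integer.Properties as ℤ
open import Data.Integer.Tactic.RingSolver using (solve-∀)
open import Data.Fin.Subset using (inside; outside)
open import Data.Vec using (Vec; []; _∷_; zipWith; map)
open import Data.Vec.Properties
  using (lookup-zipWith; zipWith-assoc; zipWith-identityˡ; zipWith-identityʳ; zipWith-inverseˡ)
open import Data.List using ([]; _∷_)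
open import Data.List.Membership.Propositional using (_∈_)
open import Data.Product using (∃-syntax; _,_; proj₁; proj₂)
open import Relation.Binary.PropositionalEquality
open ≡-Reasoning

private
  variable
    d n : ℕ
    A : PetriNet d
    a : Action d
    x y z : Config d

_++ᴿ_ : Run A x y → Run A y z → Run A x z
done            ++ᴿ s = s
step a a∈A st r ++ᴿ s = step a a∈A st (r ++ᴿ s)

toℤ : Vec ℕ n → Vec ℤ n
toℤ = map +_

infixl 6 _⊞_
_⊞_ : Vec ℤ n → Vec ℤ n → Vec ℤ n
_⊞_ = zipWith _+ℤ_

⊞-assoc : (u v w : Vec ℤ n) → (u ⊞ v) ⊞ w ≡ u ⊞ (v ⊞ w)
⊞-assoc = zipWith-assoc ℤ.+-assoc

⊞-round-trip : (u v D W : Vec ℤ n) → u ⊞ D ≡ v → v ⊞ W ≡ u → D ⊞ W ≡ zeroVec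
⊞-round-trip u v D W u+D≡v v+W≡u = begin
  D ⊞ W                          ≡⟨ zipWith-identityˡ ℤ.+-identityˡ (D ⊞ W) ⟨
  zeroVec ⊞ (D ⊞ W)              ≡⟨ cong (_⊞ (D ⊞ W)) (zipWith-inverseˡ ℤ.+-inverseˡ u) ⟨
  (map -_ u ⊞ u) ⊞ (D ⊞ W)       ≡⟨ ⊞-assoc (map -_ u) u (D ⊞ W) ⟩
  map -_ u ⊞ (u ⊞ (D ⊞ W))       ≡⟨ cong (map -_ u ⊞_) (⊞-assoc u D W) ⟨
  map -_ u ⊞ ((u ⊞ D) ⊞ W)       ≡⟨ cong (λ t → map -_ u ⊞ (t ⊞ W)) u+D≡v ⟩
  map -_ u ⊞ (v ⊞ W)             ≡⟨ cong (map -_ u ⊞_) v+W≡u ⟩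
  map -_ u ⊞ u                   ≡⟨ zipWith-inverseˡ ℤ.+-inverseˡ u ⟩
  zeroVec                        ∎

toℤ-⊕-⊖ : (p q c : Vec ℕ n) → toℤ (p ⊕ c) ⊞ zipWith _⊖_ q p ≡ toℤ (q ⊕ c)
toℤ-⊕-⊖ [] [] [] = refl
toℤ-⊕-⊖ (p ∷ ps) (q ∷ qs) (c ∷ cs) = cong₂ _∷_ head (toℤ-⊕-⊖ ps qs cs)
  where
  shift : (p q c : ℤ) → (p +ℤ c) +ℤ (q +ℤ - p) ≡ q +ℤ c
  shift = solve-∀
  head : + (p ℕ.+ c) +ℤ (q ⊖ p) ≡ + (q ℕ.+ c)
  head = begin
    + (p ℕ.+ c) +ℤ (q ⊖ p)             ≡⟨ cong₂ _+ℤ_ (ℤ.pos-+ p c) (ℤ.m-n≡m⊖n q p) ⟨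
    (+ p +ℤ + c) +ℤ (+ q +ℤ - + p)     ≡⟨ shift (+ p) (+ q) (+ c) ⟩
    + q +ℤ + c                         ≡⟨ ℤ.pos-+ q c ⟨
    + (q ℕ.+ c)                        ∎

Step-Δ : Step a x y → toℤ x ⊞ Δ a ≡ toℤ y
Step-Δ {a = a} (c , refl , refl) = toℤ-⊕-⊖ (pre a) (post a) c

restrict-⊕ : (I : Subset n) (u v : Config n) → restrict I (u ⊕ v) ≡ restrict I u ⊕ restrict I v
restrict-⊕ []            []       []       = refl
restrict-⊕ (inside ∷ I)  (_ ∷ us) (_ ∷ vs) = cong (_ ∷_) (restrict-⊕ I us vs)
restrict-⊕ (outside ∷ I) (_ ∷ us) (_ ∷ vs) = cong (0 ∷_) (restrict-⊕ I us vs)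

restrict-IConfig : (I : Subset n) (u : Config n) → IConfig I (restrict I u)
restrict-IConfig I u i i∉I rewrite lookup-zipWith keep i I u | i∉I = refl

Step⇒IStep : (I : Subset d) → Step a x y → IStep I a (restrict I x) (restrict I y)
Step⇒IStep {a = a} I (c , refl , refl) =
  restrict I c , restrict-IConfig I c , restrict-⊕ I (pre a) c , restrict-⊕ I (post a) c

module _ {C : CSet d} (sccc : IsSCCC A C) where

  private
    isClass = proj₂ sccc

  SCCC-run : C x → C y → Run A x y
  SCCC-run Cx Cy = proj₂ (proj₁ (isClass _) Cx) ++ᴿ proj₁ (proj₁ (isClass _) Cy)

  SCCC-convex : C x → C z → Run A x y → Run A y z → C y
  SCCC-convex Cx Cz x→y y→z = proj₂ (isClass _)
    ( proj₁ (proj₁ (isClass _) Cx) ++ᴿ x→y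
    , y→z ++ᴿ proj₂ (proj₁ (isClass _) Cz))

  run⇒path : (I : Subset d) → C x → C y → Run A x y →
             ∃[ w ] (Path (GT A C I) (restrict I x) (restrict I y) w × toℤ x ⊞ ΔW w ≡ toℤ y)
  run⇒path {x = x} I Cx Cy done = [] , nil , zipWith-identityʳ ℤ.+-identityʳ (toℤ x)
  run⇒path {x = x} {y} I Cx Cy (step {y = x′} a a∈A st r) =
    let Cx′ = SCCC-convex Cx Cy (step a a∈A st done) r
        (w , path , x′+w≡y) = run⇒path I Cx′ Cy r
    in a ∷ w
     , cons a (x , x′ , Cx , Cx′ , a∈A , st , refl , refl) path
     , (begin
         toℤ x ⊞ (Δ a ⊞ ΔW w)  ≡⟨ ⊞-assoc (toℤ x) (Δ a) (ΔW w) ⟨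
         toℤ x ⊞ Δ a ⊞ ΔW w    ≡⟨ cong (_⊞ ΔW w) (Step-Δ st) ⟩
         toℤ x′ ⊞ ΔW w         ≡⟨ x′+w≡y ⟩
         toℤ y                 ∎)

lemma6 : (d : ℕ) → 1 ≤ d → (A : PetriNet d) (C : CSet d) (I : Subset d) →
    IsSCCC A C → Finite (RestrictSet I C) →
    IsIUnfolding A I (GQ C I) (GT A C I) × StructurallyReversible (GT A C I)
lemma6 d _ A C I sccc@(x₀ , isClass) finite =
  ((nonempty , finite , transitions⊆) , connected , states-IConfig , transitions-IStep) , reversible
  where
  nonempty : ∃[ q ] GQ C I q
  nonempty = restrict I x₀ , x₀ , proj₂ (isClass x₀) (done , done) , refl

  transitions⊆ : ∀ p a q → GT A C I p a q → GQ C I p × a ∈ A × GQ C I q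
  transitions⊆ _ _ _ (x , y , Cx , Cy , a∈A , _ , refl , refl) = (x , Cx , refl) , a∈A , (y , Cy , refl)

  connected : StronglyConnected (GQ C I) (GT A C I)
  connected _ _ (x , Cx , refl) (y , Cy , refl) =
    let (w , path , _) = run⇒path sccc I Cx Cy (SCCC-run sccc Cx Cy) in w , path

  states-IConfig : ∀ q → GQ C I q → IConfig I q
  states-IConfig _ (x , _ , refl) = restrict-IConfig I x

  transitions-IStep : ∀ p a q → GT A C I p a q → IStep I a p q
  transitions-IStep _ _ _ (_ , _ , _ , _ , _ , st , refl , refl) = Step⇒IStep I st

  reversible : StructurallyReversible (GT A C I)
  reversible _ a _ (x , y , Cx , Cy , _ , st , refl , refl) =
    let (w , path , y+w≡x) = run⇒path sccc I Cy Cx (SCCC-run sccc Cy Cx)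
    in w , path , ⊞-round-trip (toℤ x) (toℤ y) (Δ a) (ΔW w) (Step-Δ st) y+w≡x
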